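{- Let $p>3$ be a prime number. Then $p$ is a Cantor prime if and only if $p$ satisfies an equation of the form $2pK+1=3^q$, where $q$ is the multiplicative order of $3$ modulo $p$ and $K$ is a sum of distinct powers $3^d$ with integer exponents $0\le d<q$ (that is, $K=\sum_{i=1}^n 3^{d_i}$ with distinct integers $0\le d_i<q$, $n\ge 1$; equivalently, $K$ is a positive integer all of whose base-$3$ digits are $0$ or $1$ and $K<3^q$).
   Context: The middle-third Cantor set $\mathcal{C}_3$ is the set of all $x\in[0,1]$ admitting a ternary expansion $x=\sum_{k\ge1}a_k3^{ -k}$ with every digit $a_k\in\{0,2\}$. A prime $p$ is called a Cantor prime if $1/p\in\mathcal{C}_3$. -}

module Defs where

open import Data.Nat as ℕ using (ℕ; zero; suc; _^_; _%_; NonZero; _≤_)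
open import Data.Nat.Properties using (m^n≢0)
open import Data.Integer using (+_)
open import Data.Rational using (ℚ; 0ℚ; _+_; _-_; _/_; ∣_∣; _<_)
open import Data.Product using (Σ; ∃; ∃-syntax; _×_)
open import Data.Sum using (_⊎_)
open import Relation.Binary.PropositionalEquality using (_≡_)

-- A ternary digit sequence: d k is the digit a_{k+1} (of weight 3^-(k+1)).
-- Partial sum  S n = Σ_{k<n} d k / 3^(k+1)   (exact rational).
ternaryPartial : (ℕ → ℕ) → ℕ → ℚ
ternaryPartial d zero    = 0ℚ
ternaryPartial d (suc n) =
  ternaryPartial d n + _/_ (+ d n) (3 ^ suc n) {{m^n≢0 3 (suc n)}}

SeriesSumsTo : (ℕ → ℕ) → ℚ → Set
SeriesSumsTo d x =
  ∀ (ε : ℚ) → 0ℚ < ε → ∃[ N ] (∀ n → N ≤ n → ∣ x - ternaryPartial d n ∣ < ε)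

InCantor : ℚ → Set
InCantor x = ∃[ d ] ((∀ k → d k ≡ 0 ⊎ d k ≡ 2) × SeriesSumsTo d x)

-- p is a Cantor prime (primality is required separately in the theorem).
CantorPrime : (p : ℕ) → .{{NonZero p}} → Set
CantorPrime p = InCantor (+ 1 / p)

IsMultOrder : (a p q : ℕ) → .{{NonZero p}} → Set
IsMultOrder a p q =
  (0 ℕ.< q) × (a ^ q % p ≡ 1 % p) ×
  (∀ r → 0 ℕ.< r → a ^ r % p ≡ 1 % p → q ≤ r)

module Submission where

-- Let q be the order of 3 modulo p and A = (3^q - 1)/p. Then 1/p = A/(3^q - 1), so the ternary
-- expansion of 1/p obtained by long division is purely periodic, its period being the q-digit
-- numeral of A. Conversely, for any expansion of 1/p with digits at most 2, the number formed by
-- its first q digits is pinned down to A, because a long enough prefix approximates 1/p within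
-- 1/(p 3^q). Hence 1/p is in the Cantor set iff all ternary digits of A are 0 or 2, i.e.
-- A = 2K with K a sum of distinct powers 3^d, d < q. The order exists by the pigeonhole
-- principle applied to the residues of the powers of 3.

open import Defs
open import Data.Nat
open import Data.Nat.Properties
open import Data.Nat.DivMod
open import Data.Nat.Divisibility using (_∣_; divides; n∣m*n; _∣0; ∣1⇒≡1; >⇒∤)
open import Data.Nat.Primality using (Prime; euclidsLemma; ¬prime[1])
open import Data.Fin using (toℕ; fromℕ<)
import Data.Fin.Properties as FinP
open import Data.Nat.ListAction using (sum)
open import Data.Nat.Tactic.RingSolver using (solve-∀)
open import Data.Integer as ℤ using (+_)
import Data.Integer.Properties as ℤP
open import Data.Rational as ℚ using (ℚ; 0ℚ; mkℚ; toℚᵘ)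
import Data.Rational.Properties as ℚP
open import Data.Rational.Unnormalised as ℚᵘ using (mkℚᵘ; _≃_; *≡*; *<*)
import Data.Rational.Unnormalised.Properties as ℚᵘP
open import Data.List using (List; []; _∷_; map; length)
open import Data.List.Relation.Unary.All using (All; []; _∷_; universal)
import Data.List.Relation.Unary.All.Properties as All
open import Data.List.Relation.Unary.Unique.Propositional using (Unique)
import Data.List.Relation.Unary.Unique.Propositional.Properties as Unique
open import Data.List.Relation.Unary.AllPairs.Core using ([]; _∷_)
open import Data.Product using (∃; ∃-syntax; _×_; _,_; proj₁; proj₂)
open import Data.Sum using (_⊎_; inj₁; inj₂; [_,_]′)
open import Function using (_∘_; _⇔_; mk⇔; Equivalence)
open import Relation.Binary.PropositionalEquality
open import Relation.Nullary using (¬_; yes; no; contradiction)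
open import Relation.Nullary.Decidable using (_×-dec_)
open import Relation.Unary using (Decidable)
open import Relation.Binary.Definitions using (tri<; tri≈; tri>)

fromDigits : (ℕ → ℕ) → ℕ → ℕ
fromDigits f zero    = 0
fromDigits f (suc n) = f 0 + 3 * fromDigits (f ∘ suc) n

fromDigits-0 : ∀ n → fromDigits (λ _ → 0) n ≡ 0
fromDigits-0 zero    = refl
fromDigits-0 (suc n) = cong (3 *_) (fromDigits-0 n)

fromDigits-+ : ∀ f g n → fromDigits (λ j → f j + g j) n ≡ fromDigits f n + fromDigits g n
fromDigits-+ f g zero    = refl
fromDigits-+ f g (suc n) =
  trans (cong (λ s → f 0 + g 0 + 3 * s) (fromDigits-+ (f ∘ suc) (g ∘ suc) n))
        (interchange (f 0) (g 0) (fromDigits (f ∘ suc) n) (fromDigits (g ∘ suc) n))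
  where
  interchange : ∀ a b x y → a + b + 3 * (x + y) ≡ a + 3 * x + (b + 3 * y)
  interchange = solve-∀

digit+3*-injective : ∀ {a b x y} → a < 3 → b < 3 → a + 3 * x ≡ b + 3 * y → a ≡ b × x ≡ y
digit+3*-injective {a} {b} {x} {y} a<3 b<3 eq =
  a≡b , *-cancelˡ-≡ x y 3 (+-cancelˡ-≡ b _ _ (subst (λ c → c + 3 * x ≡ b + 3 * y) a≡b eq))
  where
  digit : ∀ c z → c < 3 → (c + 3 * z) % 3 ≡ c
  digit c z c<3 = trans (cong (λ w → (c + w) % 3) (*-comm 3 z))
                        (trans ([m+kn]%n≡m%n c z 3) (m<n⇒m%n≡m c<3))
  a≡b : a ≡ b
  a≡b = trans (sym (digit a x a<3)) (trans (cong (_% 3) eq) (digit b y b<3))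

fromDigits-injective : ∀ {f g} n → (∀ j → f j < 3) → (∀ j → g j < 3) →
                       fromDigits f n ≡ fromDigits g n → ∀ {j} → j < n → f j ≡ g j
fromDigits-injective {f} {g} (suc n) f<3 g<3 eq {j} j<n
  with digit+3*-injective {x = fromDigits (f ∘ suc) n} {y = fromDigits (g ∘ suc) n} (f<3 0) (g<3 0) eq
fromDigits-injective (suc n) f<3 g<3 eq {zero}  _         | f0≡g0 , _ = f0≡g0
fromDigits-injective (suc n) f<3 g<3 eq {suc j} (s≤s j<n) | _ , rest≡ =
  fromDigits-injective n (f<3 ∘ suc) (g<3 ∘ suc) rest≡ j<n

powerDigits : ℕ → ℕ → ℕ
powerDigits zero    zero    = 1
powerDigits zero    (suc j) = 0
powerDigits (suc x) zero    = 0
powerDigits (suc x) (suc j) = powerDigits x j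

powerDigits-self : ∀ x → powerDigits x x ≡ 1
powerDigits-self zero    = refl
powerDigits-self (suc x) = powerDigits-self x

powerDigits-≢ : ∀ {x j} → x ≢ j → powerDigits x j ≡ 0
powerDigits-≢ {zero}  {zero}  x≢j = contradiction refl x≢j
powerDigits-≢ {zero}  {suc j} x≢j = refl
powerDigits-≢ {suc x} {zero}  x≢j = refl
powerDigits-≢ {suc x} {suc j} x≢j = powerDigits-≢ (x≢j ∘ cong suc)

fromDigits-powerDigits : ∀ {x n} → x < n → fromDigits (powerDigits x) n ≡ 3 ^ x
fromDigits-powerDigits {zero}  {suc n} _         = cong (λ s → 1 + 3 * s) (fromDigits-0 n)
fromDigits-powerDigits {suc x} {suc n} (s≤s x<n) = cong (3 *_) (fromDigits-powerDigits x<n)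

occurrences : List ℕ → ℕ → ℕ
occurrences []       j = 0
occurrences (x ∷ xs) j = powerDigits x j + occurrences xs j

fromDigits-occurrences : ∀ {n} xs → All (_< n) xs → fromDigits (occurrences xs) n ≡ sum (map (3 ^_) xs)
fromDigits-occurrences {n} []       []           = fromDigits-0 n
fromDigits-occurrences {n} (x ∷ xs) (x<n ∷ xs<n) =
  trans (fromDigits-+ (powerDigits x) (occurrences xs) n)
        (cong₂ _+_ (fromDigits-powerDigits x<n) (fromDigits-occurrences xs xs<n))

occurrences-∉ : ∀ {j} xs → All (j ≢_) xs → occurrences xs j ≡ 0
occurrences-∉ []       []             = refl
occurrences-∉ (x ∷ xs) (j≢x ∷ j∉xs) = cong₂ _+_ (powerDigits-≢ (j≢x ∘ sym)) (occurrences-∉ xs j∉xs)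

occurrences-unique : ∀ {xs} → Unique xs → ∀ j → occurrences xs j ≡ 0 ⊎ occurrences xs j ≡ 1
occurrences-unique {[]}     []             j = inj₁ refl
occurrences-unique {x ∷ xs} (x∉xs ∷ uxs) j with x ≟ j
... | yes refl = inj₂ (cong₂ _+_ (powerDigits-self x) (occurrences-∉ xs x∉xs))
... | no x≢j with occurrences-unique uxs j
...   | inj₁ eq = inj₁ (cong₂ _+_ (powerDigits-≢ x≢j) eq)
...   | inj₂ eq = inj₂ (cong₂ _+_ (powerDigits-≢ x≢j) eq)

CantorDigit : ℕ → Set
CantorDigit x = x ≡ 0 ⊎ x ≡ 2

cantorDigit≤2 : ∀ {x} → CantorDigit x → x ≤ 2
cantorDigit≤2 (inj₁ refl) = z≤n
cantorDigit≤2 (inj₂ refl) = ≤-refl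

twiceOccurrences-cantor : ∀ {xs} → Unique xs → ∀ j → CantorDigit (occurrences xs j + occurrences xs j)
twiceOccurrences-cantor uxs j with occurrences-unique uxs j
... | inj₁ o≡0 = inj₁ (cong₂ _+_ o≡0 o≡0)
... | inj₂ o≡1 = inj₂ (cong₂ _+_ o≡1 o≡1)

ternaryNumerator : (ℕ → ℕ) → ℕ → ℕ
ternaryNumerator d zero    = 0
ternaryNumerator d (suc n) = 3 * ternaryNumerator d n + d n

ternaryNumerator≡fromDigits-reverse : ∀ d n → ternaryNumerator d n ≡ fromDigits (λ j → d (n ∸ suc j)) n
ternaryNumerator≡fromDigits-reverse d zero    = refl
ternaryNumerator≡fromDigits-reverse d (suc n) =
  trans (+-comm (3 * ternaryNumerator d n) (d n))
        (cong (λ s → d n + 3 * s) (ternaryNumerator≡fromDigits-reverse d n))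

ternaryNumerator-+ : ∀ d m n →
  ternaryNumerator d (m + n) ≡ 3 ^ n * ternaryNumerator d m + ternaryNumerator (λ k → d (m + k)) n
ternaryNumerator-+ d m zero    =
  trans (cong (ternaryNumerator d) (+-identityʳ m))
        (sym (trans (+-identityʳ (1 * ternaryNumerator d m)) (*-identityˡ _)))
ternaryNumerator-+ d m (suc n) = begin
  ternaryNumerator d (m + suc n)            ≡⟨ cong (ternaryNumerator d) (+-suc m n) ⟩
  3 * ternaryNumerator d (m + n) + d (m + n) ≡⟨ cong (λ s → 3 * s + d (m + n)) (ternaryNumerator-+ d m n) ⟩
  3 * (3 ^ n * N + R) + d (m + n)            ≡⟨ shift (3 ^ n) N R (d (m + n)) ⟩
  3 ^ suc n * N + (3 * R + d (m + n))        ∎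
  where
  open ≡-Reasoning
  N = ternaryNumerator d m
  R = ternaryNumerator (λ k → d (m + k)) n
  shift : ∀ u x r e → 3 * (u * x + r) + e ≡ 3 * u * x + (3 * r + e)
  shift = solve-∀

ternaryNumerator<3^ : ∀ {d} → (∀ k → d k ≤ 2) → ∀ n → ternaryNumerator d n < 3 ^ n
ternaryNumerator<3^ d≤2 zero    = s≤s z≤n
ternaryNumerator<3^ {d} d≤2 (suc n) = begin-strict
  3 * ternaryNumerator d n + d n ≤⟨ +-monoʳ-≤ _ (d≤2 n) ⟩
  3 * ternaryNumerator d n + 2   <⟨ +-monoʳ-< _ (n<1+n 2) ⟩
  3 * ternaryNumerator d n + 3   ≡⟨ +-comm _ 3 ⟩
  3 + 3 * ternaryNumerator d n   ≡⟨ *-suc 3 _ ⟨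
  3 * suc (ternaryNumerator d n) ≤⟨ *-monoʳ-≤ 3 (ternaryNumerator<3^ d≤2 n) ⟩
  3 ^ suc n                      ∎
  where open ≤-Reasoning

sum-3^-map-suc : ∀ ds → sum (map (3 ^_) (map suc ds)) ≡ 3 * sum (map (3 ^_) ds)
sum-3^-map-suc []       = refl
sum-3^-map-suc (d ∷ ds) =
  trans (cong (_+_ (3 ^ suc d)) (sum-3^-map-suc ds)) (sym (*-distribˡ-+ 3 (3 ^ d) _))

ternaryNumerator-cantorDigits : ∀ {d} → (∀ k → CantorDigit (d k)) → ∀ n →
  ∃[ ds ] (Unique ds × All (_< n) ds × ternaryNumerator d n ≡ 2 * sum (map (3 ^_) ds))
ternaryNumerator-cantorDigits d-cantor zero = [] , [] , [] , refl
ternaryNumerator-cantorDigits {d} d-cantor (suc n)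
  with ds , uds , ds<n , eq ← ternaryNumerator-cantorDigits d-cantor n | d-cantor n
... | inj₁ dn≡0 = map suc ds , Unique.map⁺ suc-injective uds , All.gmap⁺ s≤s ds<n ,
  (begin
    3 * ternaryNumerator d n + d n ≡⟨ cong₂ (λ s t → 3 * s + t) eq dn≡0 ⟩
    3 * (2 * S) + 0                ≡⟨ append0 S ⟩
    2 * (3 * S)                    ≡⟨ cong (2 *_) (sum-3^-map-suc ds) ⟨
    2 * sum (map (3 ^_) (map suc ds)) ∎)
  where
  open ≡-Reasoning
  S = sum (map (3 ^_) ds)
  append0 : ∀ S → 3 * (2 * S) + 0 ≡ 2 * (3 * S)
  append0 = solve-∀
... | inj₂ dn≡2 = 0 ∷ map suc ds , All.map⁺ (universal (λ _ ()) ds) ∷ Unique.map⁺ suc-injective uds ,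
  s≤s z≤n ∷ All.gmap⁺ s≤s ds<n ,
  (begin
    3 * ternaryNumerator d n + d n ≡⟨ cong₂ (λ s t → 3 * s + t) eq dn≡2 ⟩
    3 * (2 * S) + 2                ≡⟨ append2 S ⟩
    2 * (1 + 3 * S)                ≡⟨ cong (λ s → 2 * (1 + s)) (sum-3^-map-suc ds) ⟨
    2 * sum (map (3 ^_) (0 ∷ map suc ds)) ∎)
  where
  open ≡-Reasoning
  S = sum (map (3 ^_) ds)
  append2 : ∀ S → 3 * (2 * S) + 2 ≡ 2 * (1 + 3 * S)
  append2 = solve-∀

toℚᵘ-/ : ∀ i n .{{_ : NonZero n}} → toℚᵘ (i ℚ./ n) ≃ i ℚᵘ./ n
toℚᵘ-/ i (suc n) = ℚP.toℚᵘ-fromℚᵘ (mkℚᵘ i n)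

/+/3* : ∀ a b m .{{_ : NonZero m}} → let instance _ = m*n≢0 3 m in
        (+ a ℚᵘ./ m) ℚᵘ.+ (+ b ℚᵘ./ (3 * m)) ≃ + (3 * a + b) ℚᵘ./ (3 * m)
/+/3* a b m@(suc _) = *≡* (begin
  (+ a ℤ.* + (3 * m) ℤ.+ + b ℤ.* + m) ℤ.* + (3 * m)
    ≡⟨ cong (ℤ._* + (3 * m)) (cong₂ ℤ._+_ (ℤP.pos-* a (3 * m)) (ℤP.pos-* b m)) ⟨
  (+ (a * (3 * m)) ℤ.+ + (b * m)) ℤ.* + (3 * m)
    ≡⟨ cong (ℤ._* + (3 * m)) (ℤP.pos-+ (a * (3 * m)) (b * m)) ⟨
  + (a * (3 * m) + b * m) ℤ.* + (3 * m)
    ≡⟨ ℤP.pos-* (a * (3 * m) + b * m) (3 * m) ⟨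
  + ((a * (3 * m) + b * m) * (3 * m))
    ≡⟨ cong +_ (cross-multiply a b m) ⟩
  + ((3 * a + b) * (m * (3 * m)))
    ≡⟨ ℤP.pos-* (3 * a + b) (m * (3 * m)) ⟩
  + (3 * a + b) ℤ.* + (m * (3 * m)) ∎)
  where
  open ≡-Reasoning
  cross-multiply : ∀ a b m → (a * (3 * m) + b * m) * (3 * m) ≡ (3 * a + b) * (m * (3 * m))
  cross-multiply = solve-∀

ternaryPartial≃numerator/3^ : ∀ d n →
  toℚᵘ (ternaryPartial d n) ≃ (+ ternaryNumerator d n ℚᵘ./ 3 ^ n) {{m^n≢0 3 n}}
ternaryPartial≃numerator/3^ d zero    = ℚᵘP.≃-refl
ternaryPartial≃numerator/3^ d (suc n) = ℚᵘP.≃-trans (ℚP.toℚᵘ-homo-+ (ternaryPartial d n) _)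
  (ℚᵘP.≃-trans (ℚᵘP.+-cong (ternaryPartial≃numerator/3^ d n) (toℚᵘ-/ (+ d n) (3 ^ suc n) {{m^n≢0 3 (suc n)}}))
               (/+/3* (ternaryNumerator d n) (d n) (3 ^ n) {{m^n≢0 3 n}}))

∣↥[1/p-a/M]∣≡∣M-a*p∣ : ∀ a M p → ℤ.∣ + 1 ℤ.* + M ℤ.+ (ℤ.- + a) ℤ.* + p ∣ ≡ ∣ M - a * p ∣
∣↥[1/p-a/M]∣≡∣M-a*p∣ a M p
  rewrite ℤP.*-identityˡ (+ M) | sym (ℤP.neg-distribˡ-* (+ a) (+ p))
        | ℤP.+◃n≡+n (a * p) | ℤP.m-n≡m⊖n M (a * p)
  with ≤-total (a * p) M
... | inj₁ ap≤M = trans (cong ℤ.∣_∣ (ℤP.⊖-≥ ap≤M)) (sym (m≤n⇒∣n-m∣≡n∸m ap≤M))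
... | inj₂ M≤ap = trans (ℤP.∣⊖∣-≤ M≤ap) (sym (m≤n⇒∣m-n∣≡n∸m M≤ap))

∣1/p-a/M∣<c/D⇔ : ∀ p M a c D .{{_ : NonZero p}} .{{_ : NonZero M}} .{{_ : NonZero D}} →
  ℚᵘ.∣ (+ 1 ℚᵘ./ p) ℚᵘ.- (+ a ℚᵘ./ M) ∣ ℚᵘ.< + c ℚᵘ./ D ⇔ ∣ M - a * p ∣ * D < c * (p * M)
∣1/p-a/M∣<c/D⇔ p@(suc _) M@(suc _) a c D@(suc _) = mk⇔
  (λ { (*<* lt) → subst (λ x → x * D < c * (p * M)) (∣↥[1/p-a/M]∣≡∣M-a*p∣ a M p) (ℤP.+◃-cancel-< lt) })
  (λ lt → *<* (ℤP.+◃-mono-< (subst (λ x → x * D < c * (p * M)) (sym (∣↥[1/p-a/M]∣≡∣M-a*p∣ a M p)) lt)))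

∣1/p-S∣<ε⇔ : ∀ p M a c D .{{_ : NonZero p}} .{{_ : NonZero M}} .{{_ : NonZero D}} {S ε : ℚ} →
  toℚᵘ S ≃ + a ℚᵘ./ M → toℚᵘ ε ≃ + c ℚᵘ./ D →
  ℚ.∣ + 1 ℚ./ p ℚ.- S ∣ ℚ.< ε ⇔ ∣ M - a * p ∣ * D < c * (p * M)
∣1/p-S∣<ε⇔ p M a c D {S} {ε} S≃a/M ε≃c/D = mk⇔
  (λ lt → Equivalence.to (∣1/p-a/M∣<c/D⇔ p M a c D)
            (ℚᵘP.<-respʳ-≃ ε≃c/D (ℚᵘP.<-respˡ-≃ dist≃ (ℚP.toℚᵘ-mono-< lt))))
  (λ lt → ℚP.toℚᵘ-cancel-< (ℚᵘP.<-respʳ-≃ (ℚᵘP.≃-sym ε≃c/D) (ℚᵘP.<-respˡ-≃ (ℚᵘP.≃-sym dist≃)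
            (Equivalence.from (∣1/p-a/M∣<c/D⇔ p M a c D) lt))))
  where
  dist≃ : toℚᵘ ℚ.∣ + 1 ℚ./ p ℚ.- S ∣ ≃ ℚᵘ.∣ (+ 1 ℚᵘ./ p) ℚᵘ.- (+ a ℚᵘ./ M) ∣
  dist≃ = ℚᵘP.≃-trans (ℚP.toℚᵘ-homo-∣-∣ (+ 1 ℚ./ p ℚ.- S))
    (ℚᵘP.∣-∣-cong (ℚᵘP.≃-trans (ℚP.toℚᵘ-homo-+ (+ 1 ℚ./ p) (ℚ.- S))
      (ℚᵘP.+-cong (toℚᵘ-/ (+ 1) p) (ℚᵘP.≃-trans (ℚP.toℚᵘ-homo‿- S) (ℚᵘP.-‿cong S≃a/M)))))

m+n≤o⇒m≤∣o-n∣ : ∀ {m n o} → m + n ≤ o → m ≤ ∣ o - n ∣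
m+n≤o⇒m≤∣o-n∣ {m} {n} {o} m+n≤o = ≤-trans (m+n≤o⇒m≤o∸n m m+n≤o) (m∸n≤∣m-n∣ o n)

-- (u X + T) / ((p A + 1) u) with T < u approximates 1/p to within 1/(p (p A + 1)) only if X = A.
approximant-quotient≡ : ∀ {p A u X T} → 2 ≤ p → T < u →
                        ∣ (p * A + 1) * u - (u * X + T) * p ∣ < u → X ≡ A
approximant-quotient≡ {p} {A} {u} {X} {T} p≥2 T<u close with <-cmp X A
... | tri≈ _ X≡A _ = X≡A
... | tri< X<A _ _ = contradiction close (≤⇒≯ (m+n≤o⇒m≤∣o-n∣ (begin
  u + (u * X + T) * p  ≤⟨ +-monoʳ-≤ u (*-monoˡ-≤ p (+-monoʳ-≤ (u * X) (<⇒≤ T<u))) ⟩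
  u + (u * X + u) * p  ≡⟨ cong (λ s → u + s * p) (trans (+-comm (u * X) u) (sym (*-suc u X))) ⟩
  u + u * suc X * p    ≤⟨ +-monoʳ-≤ u (*-monoˡ-≤ p (*-monoʳ-≤ u X<A)) ⟩
  u + u * A * p        ≡⟨ rearrange u A p ⟩
  (p * A + 1) * u      ∎)))
  where
  open ≤-Reasoning
  rearrange : ∀ u A p → u + u * A * p ≡ (p * A + 1) * u
  rearrange = solve-∀
... | tri> _ _ A<X = contradiction close
  (≤⇒≯ (subst (u ≤_) (∣-∣-comm ((u * X + T) * p) ((p * A + 1) * u)) (m+n≤o⇒m≤∣o-n∣ (begin
  u + (p * A + 1) * u  ≡⟨ rearrange u A p ⟩
  u * A * p + u * 2    ≤⟨ +-monoʳ-≤ (u * A * p) (*-monoʳ-≤ u p≥2) ⟩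
  u * A * p + u * p    ≡⟨ rearrange′ u A p ⟩
  u * suc A * p        ≤⟨ *-monoˡ-≤ p (*-monoʳ-≤ u A<X) ⟩
  u * X * p            ≤⟨ *-monoˡ-≤ p (m≤m+n (u * X) T) ⟩
  (u * X + T) * p      ∎))))
  where
  open ≤-Reasoning
  rearrange : ∀ u A p → u + (p * A + 1) * u ≡ u * A * p + u * 2
  rearrange = solve-∀
  rearrange′ : ∀ u A p → u * A * p + u * p ≡ u * suc A * p
  rearrange′ = solve-∀

expansion-numerator≡ : ∀ {p d q A} .{{_ : NonZero p}} → 2 ≤ p → (∀ k → d k ≤ 2) →
                       SeriesSumsTo d (+ 1 ℚ./ p) → 3 ^ q ≡ p * A + 1 → ternaryNumerator d q ≡ A
expansion-numerator≡ {p} {d} {q} {A} p≥2 d≤2 sums 3^q≡ =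
  approximant-quotient≡ p≥2 (ternaryNumerator<3^ (λ k → d≤2 (q + k)) N) close
  where
  Q = 3 ^ q
  instance
    Q≢0 : NonZero Q
    Q≢0 = m^n≢0 3 q
    pQ≢0 : NonZero (p * Q)
    pQ≢0 = m*n≢0 p Q
  ε : ℚ
  ε = + 1 ℚ./ (p * Q)
  ε>0 : 0ℚ ℚ.< ε
  ε>0 = ℚP.positive⁻¹ ε {{ℚP.normalize-pos 1 (p * Q)}}
  N = proj₁ (sums ε ε>0)
  m = q + N
  u = 3 ^ N
  instance
    3^m≢0 : NonZero (3 ^ m)
    3^m≢0 = m^n≢0 3 m
  close-ℕ : ∣ 3 ^ m - ternaryNumerator d m * p ∣ * (p * Q) < 1 * (p * 3 ^ m)
  close-ℕ = Equivalence.to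
    (∣1/p-S∣<ε⇔ p (3 ^ m) (ternaryNumerator d m) 1 (p * Q)
       (ternaryPartial≃numerator/3^ d m) (toℚᵘ-/ (+ 1) (p * Q)))
    (proj₂ (sums ε ε>0) m (m≤n+m N q))
  3^m≡ : 3 ^ m ≡ (p * A + 1) * u
  3^m≡ = trans (^-distribˡ-+-* 3 q N) (cong (_* u) 3^q≡)
  R = ternaryNumerator (λ k → d (q + k)) N
  close : ∣ (p * A + 1) * u - (u * ternaryNumerator d q + R) * p ∣ < u
  close = *-cancelʳ-< (p * Q) _ _ (begin-strict
    ∣ (p * A + 1) * u - (u * ternaryNumerator d q + R) * p ∣ * (p * Q)
      ≡⟨ cong₂ (λ a b → ∣ a - b * p ∣ * (p * Q)) 3^m≡ (ternaryNumerator-+ d q N) ⟨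
    ∣ 3 ^ m - ternaryNumerator d m * p ∣ * (p * Q)  <⟨ close-ℕ ⟩
    1 * (p * 3 ^ m)                                  ≡⟨ cong (λ a → 1 * (p * a)) (^-distribˡ-+-* 3 q N) ⟩
    1 * (p * (Q * u))                                ≡⟨ rearrange p Q u ⟩
    u * (p * Q)                                      ∎)
    where
    open ≤-Reasoning
    rearrange : ∀ p Q u → 1 * (p * (Q * u)) ≡ u * (p * Q)
    rearrange = solve-∀

cantor⇒periodDigits : ∀ {p q} .{{_ : NonZero p}} → 2 ≤ p → InCantor (+ 1 ℚ./ p) → 3 ^ q % p ≡ 1 % p →
  ∃[ ds ] (Unique ds × All (_< q) ds × 2 * p * sum (map (3 ^_) ds) + 1 ≡ 3 ^ q)
cantor⇒periodDigits {p} {q} p≥2 (d , d-cantor , sums) 3^q%p≡1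
  with ds , uds , ds<q , numerator≡ ← ternaryNumerator-cantorDigits d-cantor q
  = ds , uds , ds<q , (begin
    2 * p * K + 1             ≡⟨ cong (_+ 1) (*-comm-middle p K) ⟩
    p * (2 * K) + 1           ≡⟨ cong (λ x → p * x + 1) numerator≡ ⟨
    p * ternaryNumerator d q + 1
      ≡⟨ cong (λ x → p * x + 1) (expansion-numerator≡ {q = q} p≥2 (cantorDigit≤2 ∘ d-cantor) sums 3^q≡) ⟩
    p * (3 ^ q / p) + 1       ≡⟨ 3^q≡ ⟨
    3 ^ q                     ∎)
  where
  open ≡-Reasoning
  K = sum (map (3 ^_) ds)
  *-comm-middle : ∀ p K → 2 * p * K ≡ p * (2 * K)
  *-comm-middle = solve-∀
  3^q≡ : 3 ^ q ≡ p * (3 ^ q / p) + 1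
  3^q≡ = begin
    3 ^ q                   ≡⟨ m≡m%n+[m/n]*n (3 ^ q) p ⟩
    3 ^ q % p + 3 ^ q / p * p ≡⟨ cong₂ _+_ (trans 3^q%p≡1 (m<n⇒m%n≡m p≥2)) (*-comm (3 ^ q / p) p) ⟩
    1 + p * (3 ^ q / p)     ≡⟨ +-comm 1 _ ⟩
    p * (3 ^ q / p) + 1     ∎

^%-periodic : ∀ {a p q} .{{_ : NonZero p}} → a ^ q % p ≡ 1 % p → ∀ k r → a ^ (k * q + r) % p ≡ a ^ r % p
^%-periodic             a^q≡1 zero    r = refl
^%-periodic {a} {p} {q} a^q≡1 (suc k) r = begin
  a ^ (q + k * q + r) % p                   ≡⟨ cong (λ e → a ^ e % p) (+-assoc q (k * q) r) ⟩
  a ^ (q + (k * q + r)) % p                 ≡⟨ cong (_% p) (^-distribˡ-+-* a q (k * q + r)) ⟩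
  a ^ q * a ^ (k * q + r) % p               ≡⟨ %-distribˡ-* (a ^ q) _ p ⟩
  a ^ q % p * (a ^ (k * q + r) % p) % p     ≡⟨ cong₂ (λ x y → x * y % p) a^q≡1 (^%-periodic a^q≡1 k r) ⟩
  1 % p * (a ^ r % p) % p                   ≡⟨ %-distribˡ-* 1 (a ^ r) p ⟨
  1 * a ^ r % p                             ≡⟨ cong (_% p) (*-identityˡ (a ^ r)) ⟩
  a ^ r % p                                 ∎
  where open ≡-Reasoning

-- Long division: the remainder after n steps is 3 ^ n % p.
reciprocalDigit : (p : ℕ) .{{_ : NonZero p}} → ℕ → ℕ
reciprocalDigit p n = 3 * (3 ^ n % p) / p

module _ {p : ℕ} .{{p≢0 : NonZero p}} where

  reciprocalDigit<3 : ∀ n → reciprocalDigit p n < 3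
  reciprocalDigit<3 n = m<n*o⇒m/o<n (*-monoʳ-< 3 (m%n<n (3 ^ n) p))

  ternaryNumerator-reciprocalDigit : 2 ≤ p → ∀ n → ternaryNumerator (reciprocalDigit p) n ≡ 3 ^ n / p
  ternaryNumerator-reciprocalDigit p≥2 zero    = sym (m<n⇒m/n≡0 p≥2)
  ternaryNumerator-reciprocalDigit p≥2 (suc n) = sym (begin
    3 * 3 ^ n / p                     ≡⟨ /-congˡ (cong (3 *_) (m≡m%n+[m/n]*n (3 ^ n) p)) ⟩
    3 * (r + a * p) / p               ≡⟨ /-congˡ (distribute r a p) ⟩
    (3 * r + 3 * a * p) / p           ≡⟨ +-distrib-/-∣ʳ (3 * r) (n∣m*n (3 * a)) ⟩
    3 * r / p + 3 * a * p / p         ≡⟨ cong (_+_ (3 * r / p)) (m*n/n≡m (3 * a) p) ⟩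
    3 * r / p + 3 * a                 ≡⟨ +-comm (3 * r / p) (3 * a) ⟩
    3 * a + reciprocalDigit p n       ≡⟨ cong (λ s → 3 * s + reciprocalDigit p n)
                                              (ternaryNumerator-reciprocalDigit p≥2 n) ⟨
    3 * ternaryNumerator (reciprocalDigit p) n + reciprocalDigit p n ∎)
    where
    open ≡-Reasoning
    r = 3 ^ n % p
    a = 3 ^ n / p
    distribute : ∀ r a p → 3 * (r + a * p) ≡ 3 * r + 3 * a * p
    distribute = solve-∀

  reciprocalDigits-sum : 2 ≤ p → SeriesSumsTo (reciprocalDigit p) (+ 1 ℚ./ p)
  reciprocalDigits-sum p≥2 ε ε>0 = close-for ε (ℚ.positive ε>0)
    where
    close-for : ∀ ε → ℚ.Positive ε →
                ∃[ N ] (∀ n → N ≤ n → ℚ.∣ + 1 ℚ./ p ℚ.- ternaryPartial (reciprocalDigit p) n ∣ ℚ.< ε)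
    close-for ε@(mkℚ (+ suc c) D-1 _) _ = D , λ n D≤n →
      Equivalence.from
        (∣1/p-S∣<ε⇔ p (3 ^ n) (ternaryNumerator (reciprocalDigit p) n) (suc c) D {{p≢0}} {{m^n≢0 3 n}}
           (ternaryPartial≃numerator/3^ (reciprocalDigit p) n) ℚᵘP.≃-refl)
        (begin-strict
          ∣ 3 ^ n - ternaryNumerator (reciprocalDigit p) n * p ∣ * D
            ≡⟨ cong (λ a → ∣ 3 ^ n - a * p ∣ * D) (ternaryNumerator-reciprocalDigit p≥2 n) ⟩
          ∣ 3 ^ n - 3 ^ n / p * p ∣ * D
            ≡⟨ cong (_* D) (trans (m≤n⇒∣n-m∣≡n∸m (m/n*n≤m (3 ^ n) p)) (sym (m%n≡m∸m/n*n (3 ^ n) p))) ⟩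
          3 ^ n % p * D        <⟨ *-monoˡ-< D (m%n<n (3 ^ n) p) ⟩
          p * D                ≤⟨ *-monoʳ-≤ p (≤-trans D≤n (<⇒≤ (n<3^n n))) ⟩
          p * 3 ^ n            ≤⟨ m≤n*m (p * 3 ^ n) (suc c) ⟩
          suc c * (p * 3 ^ n)  ∎)
      where
      open ≤-Reasoning
      D = suc D-1
      n<3^n : ∀ n → n < 3 ^ n
      n<3^n zero    = z<s
      n<3^n (suc n) = ≤-<-trans (n<3^n n)
        (subst (3 ^ n <_) (*-comm (3 ^ n) 3) (m<m*n (3 ^ n) 3 {{m^n≢0 3 n}} (s≤s (s≤s z≤n))))

  module _ (p≥2 : 2 ≤ p) {q ds} (uds : Unique ds) (ds<q : All (_< q) ds)
           (period : 2 * p * sum (map (3 ^_) ds) + 1 ≡ 3 ^ q) where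

    private
      K = sum (map (3 ^_) ds)

      3^q≡1+2K*p : 3 ^ q ≡ 1 + 2 * K * p
      3^q≡1+2K*p = trans (sym period) (rearrange p K)
        where
        rearrange : ∀ p K → 2 * p * K + 1 ≡ 1 + 2 * K * p
        rearrange = solve-∀

    3^q%p≡1 : 3 ^ q % p ≡ 1 % p
    3^q%p≡1 = trans (%-congˡ 3^q≡1+2K*p) ([m+kn]%n≡m%n 1 (2 * K) p)

    ternaryNumerator-reciprocalDigit-period : ternaryNumerator (reciprocalDigit p) q ≡ 2 * K
    ternaryNumerator-reciprocalDigit-period = begin
      ternaryNumerator (reciprocalDigit p) q ≡⟨ ternaryNumerator-reciprocalDigit p≥2 q ⟩
      3 ^ q / p                             ≡⟨ /-congˡ 3^q≡1+2K*p ⟩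
      (1 + 2 * K * p) / p                   ≡⟨ +-distrib-/-∣ʳ 1 (n∣m*n (2 * K)) ⟩
      1 / p + 2 * K * p / p                 ≡⟨ cong₂ _+_ (m<n⇒m/n≡0 p≥2) (m*n/n≡m (2 * K) p) ⟩
      2 * K                                 ∎
      where open ≡-Reasoning

    reciprocalDigit-period : ∀ {j} → j < q → reciprocalDigit p (q ∸ suc j) ≡ occurrences ds j + occurrences ds j
    reciprocalDigit-period = fromDigits-injective q (reciprocalDigit<3 ∘ (q ∸_) ∘ suc)
      (s≤s ∘ cantorDigit≤2 ∘ twiceOccurrences-cantor uds) (begin
      fromDigits (λ j → reciprocalDigit p (q ∸ suc j)) q ≡⟨ ternaryNumerator≡fromDigits-reverse (reciprocalDigit p) q ⟨
      ternaryNumerator (reciprocalDigit p) q ≡⟨ ternaryNumerator-reciprocalDigit-period ⟩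
      2 * K                                 ≡⟨ cong (_+_ K) (+-identityʳ K) ⟩
      K + K                                 ≡⟨ cong₂ _+_ (fromDigits-occurrences ds ds<q) (fromDigits-occurrences ds ds<q) ⟨
      fromDigits (occurrences ds) q + fromDigits (occurrences ds) q ≡⟨ fromDigits-+ (occurrences ds) (occurrences ds) q ⟨
      fromDigits (λ j → occurrences ds j + occurrences ds j) q ∎)
      where open ≡-Reasoning

    reciprocalDigit-cantor-below : ∀ {n} → n < q → CantorDigit (reciprocalDigit p n)
    reciprocalDigit-cantor-below {n} (s≤s n≤q-1) = subst CantorDigit
      (trans (sym (reciprocalDigit-period (s≤s (m∸n≤m _ n)))) (cong (reciprocalDigit p) (m∸[m∸n]≡n n≤q-1)))
      (twiceOccurrences-cantor uds (q ∸ suc n))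

    reciprocalDigit-cantor : 0 < q → ∀ n → CantorDigit (reciprocalDigit p n)
    reciprocalDigit-cantor q>0 n = subst CantorDigit digit≡ (reciprocalDigit-cantor-below (m%n<n n q))
      where
      instance _ = >-nonZero q>0
      n≡ : n / q * q + n % q ≡ n
      n≡ = trans (+-comm _ (n % q)) (sym (m≡m%n+[m/n]*n n q))
      digit≡ : reciprocalDigit p (n % q) ≡ reciprocalDigit p n
      digit≡ = trans (cong (λ x → 3 * x / p) (sym (^%-periodic 3^q%p≡1 (n / q) (n % q))))
                     (cong (reciprocalDigit p) n≡)

    periodDigits⇒cantor : 0 < q → InCantor (+ 1 ℚ./ p)
    periodDigits⇒cantor q>0 = reciprocalDigit p , reciprocalDigit-cantor q>0 , reciprocalDigits-sum p≥2

module _ {P : ℕ → Set} (P? : Decidable P) where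

  private
    search : ∀ n → (∃[ m ] (P m × ∀ {k} → k < m → ¬ P k)) ⊎ (∀ {k} → k < n → ¬ P k)
    search zero = inj₂ λ ()
    search (suc n) with search n | P? n
    ... | inj₁ least | _      = inj₁ least
    ... | inj₂ none  | yes pn = inj₁ (n , pn , none)
    ... | inj₂ none  | no ¬pn = inj₂ λ k<1+n → [ none , (λ { refl → ¬pn }) ]′ (m<1+n⇒m<n∨m≡n k<1+n)

  least-witness : ∀ {n} → P n → ∃[ m ] (P m × ∀ {k} → k < m → ¬ P k)
  least-witness {n} pn with search (suc n)
  ... | inj₁ least = least
  ... | inj₂ none  = contradiction pn (none ≤-refl)

module _ {p : ℕ} .{{_ : NonZero p}} where

  %≡%⇒∣∸ : ∀ x y → x % p ≡ y % p → p ∣ x ∸ y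
  %≡%⇒∣∸ x y eq = divides (x / p ∸ y / p) (begin
    x ∸ y                                     ≡⟨ cong₂ _∸_ (m≡m%n+[m/n]*n x p) (m≡m%n+[m/n]*n y p) ⟩
    (x % p + x / p * p) ∸ (y % p + y / p * p) ≡⟨ cong (λ r → (r + x / p * p) ∸ (y % p + y / p * p)) eq ⟩
    (y % p + x / p * p) ∸ (y % p + y / p * p) ≡⟨ [m+n]∸[m+o]≡n∸o (y % p) _ _ ⟩
    x / p * p ∸ y / p * p                     ≡⟨ *-distribʳ-∸ p (x / p) (y / p) ⟨
    (x / p ∸ y / p) * p                       ∎)
    where open ≡-Reasoning

  module _ (prime-p : Prime p) {a} (p∤a : ¬ p ∣ a) where

    p∤a^ : ∀ n → ¬ p ∣ a ^ n
    p∤a^ zero    p∣1     = ¬prime[1] (subst Prime (∣1⇒≡1 p∣1) prime-p)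
    p∤a^ (suc n) p∣a^1+n with euclidsLemma a (a ^ n) prime-p p∣a^1+n
    ... | inj₁ p∣a   = p∤a p∣a
    ... | inj₂ p∣a^n = p∤a^ n p∣a^n

    a^>0 : ∀ n → 0 < a ^ n
    a^>0 n = n≢0⇒n>0 (λ a^n≡0 → p∤a^ n (subst (p ∣_) (sym a^n≡0) (p ∣0)))

    ^%≡1-exists : ∃[ t ] (0 < t × a ^ t % p ≡ 1 % p)
    ^%≡1-exists
      with i , j , i<j , same ← FinP.pigeonhole (n<1+n p) (λ i → fromℕ< (m%n<n (a ^ toℕ i) p))
      = t , m<n⇒0<n∸m i<j , a^t%p≡1
      where
      t = toℕ j ∸ toℕ i
      residue≡ : a ^ toℕ j % p ≡ a ^ toℕ i % p
      residue≡ = sym (trans (sym (FinP.toℕ-fromℕ< _)) (trans (cong toℕ same) (FinP.toℕ-fromℕ< _)))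
      p∣a^i*[a^t∸1] : p ∣ a ^ toℕ i * (a ^ t ∸ 1)
      p∣a^i*[a^t∸1] = subst (p ∣_) (begin
        a ^ toℕ j ∸ a ^ toℕ i               ≡⟨ cong (λ e → a ^ e ∸ a ^ toℕ i) (m+[n∸m]≡n (<⇒≤ i<j)) ⟨
        a ^ (toℕ i + t) ∸ a ^ toℕ i
          ≡⟨ cong₂ _∸_ (^-distribˡ-+-* a (toℕ i) t) (sym (*-identityʳ (a ^ toℕ i))) ⟩
        a ^ toℕ i * a ^ t ∸ a ^ toℕ i * 1   ≡⟨ *-distribˡ-∸ (a ^ toℕ i) (a ^ t) 1 ⟨
        a ^ toℕ i * (a ^ t ∸ 1)             ∎) (%≡%⇒∣∸ _ _ residue≡)
        where open ≡-Reasoning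
      a^t%p≡1 : a ^ t % p ≡ 1 % p
      a^t%p≡1 with euclidsLemma (a ^ toℕ i) (a ^ t ∸ 1) prime-p p∣a^i*[a^t∸1]
      ... | inj₁ p∣a^i       = contradiction p∣a^i (p∤a^ (toℕ i))
      ... | inj₂ p∣a^t∸1 = trans (%-congˡ (sym (m+[n∸m]≡n (a^>0 t)))) (%-remove-+ʳ 1 p∣a^t∸1)

    multOrder-exists : ∃[ q ] IsMultOrder a p q
    multOrder-exists
      with q , (q>0 , a^q≡1) , minimal ← least-witness (λ r → (0 <? r) ×-dec (a ^ r % p ≟ 1 % p))
                                                        (proj₂ ^%≡1-exists)
      = q , q>0 , a^q≡1 , λ r r>0 a^r≡1 → ≮⇒≥ (λ r<q → minimal r<q (r>0 , a^r≡1))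

period-nonempty : ∀ {p q} ds → 0 < q → 2 * p * sum (map (3 ^_) ds) + 1 ≡ 3 ^ q → 1 ≤ length ds
period-nonempty     (_ ∷ _) _ _ = s≤s z≤n
period-nonempty {p} {suc q} [] _ period =
  contradiction (subst (3 ≤_) 3^q≡1 (*-monoʳ-≤ 3 (m^n>0 3 q))) λ { (s≤s ()) }
  where
  3^q≡1 : 3 ^ suc q ≡ 1
  3^q≡1 = trans (sym period) (cong (_+ 1) (*-zeroʳ (2 * p)))

theorem2p1 : ∀ (p : ℕ) .{{_ : NonZero p}} → Prime p → 3 < p →
    (CantorPrime p ⇔
      (∃[ q ] ∃[ K ] (IsMultOrder 3 p q × (2 * p * K + 1 ≡ 3 ^ q) ×
        (∃[ ds ] (1 ≤ length ds × Unique ds × All (_< q) ds ×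
                  K ≡ sum (map (3 ^_) ds))))))
theorem2p1 p prime-p p>3 = mk⇔
  (λ cantor →
    let q , order = multOrder-exists prime-p (>⇒∤ p>3)
        ds , uds , ds<q , period = cantor⇒periodDigits p≥2 cantor (proj₁ (proj₂ order))
    in q , sum (map (3 ^_) ds) , order , period , ds , period-nonempty {p} ds (proj₁ order) period , uds , ds<q , refl)
  (λ { (q , _ , (q>0 , _) , period , ds , _ , uds , ds<q , refl) → periodDigits⇒cantor p≥2 uds ds<q period q>0 })
  where
  p≥2 : 2 ≤ p
  p≥2 = ≤-trans (n≤1+n 2) (<⇒≤ p>3)
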